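{- Let $S$ be a semigroup. The inclusion ideal graph $\mathcal{I}n(S)$ is disconnected if and only if $S$ is the union of exactly two minimal left ideals.
   Context: A left ideal of a semigroup $S$ is a non-empty subset $I$ with $SI\subseteq I$; it is nontrivial if $I\neq S$, and minimal if it properly contains no left ideal of $S$. The inclusion ideal graph $\mathcal{I}n(S)$ is the simple undirected graph whose vertices are the nontrivial left ideals of $S$, with distinct $I,J$ adjacent iff $I\subset J$ or $J\subset I$. -}

module Defs where

open import Level using (Level; _⊔_) renaming (suc to lsuc)
open import Algebra.Bundles using (Semigroup)
open import Data.Product using (Σ; ∃; _×_; _,_)
open import Data.Sum using (_⊎_)
open import Relation.Nullary using (¬_)

module _ {c ℓ : Level} (S : Semigroup c ℓ) (p : Level) where
  open Semigroup S

  record LeftIdeal : Set (c ⊔ ℓ ⊔ lsuc p) where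
    field
      mem      : Carrier → Set p
      respects : ∀ {x y} → x ≈ y → mem x → mem y
      nonempty : ∃ λ x → mem x
      closed   : ∀ s x → mem x → mem (s ∙ x)
  open LeftIdeal public

  _⊆ᴵ_ : LeftIdeal → LeftIdeal → Set (c ⊔ p)
  I ⊆ᴵ J = ∀ x → mem I x → mem J x

  _≐ᴵ_ : LeftIdeal → LeftIdeal → Set (c ⊔ p)
  I ≐ᴵ J = (I ⊆ᴵ J) × (J ⊆ᴵ I)

  _⊂ᴵ_ : LeftIdeal → LeftIdeal → Set (c ⊔ p)
  I ⊂ᴵ J = (I ⊆ᴵ J) × ¬ (J ⊆ᴵ I)

  Nontrivial : LeftIdeal → Set (c ⊔ p)
  Nontrivial I = ¬ (∀ x → mem I x)

  Minimal : LeftIdeal → Set (c ⊔ ℓ ⊔ lsuc p)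
  Minimal I = ¬ (Σ LeftIdeal λ K → K ⊂ᴵ I)

  Vertex : Set (c ⊔ ℓ ⊔ lsuc p)
  Vertex = Σ LeftIdeal Nontrivial

  ideal : Vertex → LeftIdeal
  ideal (I , _) = I

  -- adjacency: I ⊂ J or J ⊂ I (this forces I, J distinct as sets)
  Adjacent : Vertex → Vertex → Set (c ⊔ p)
  Adjacent I J = (ideal I ⊂ᴵ ideal J) ⊎ (ideal J ⊂ᴵ ideal I)

  -- walks in In(S); vertices equal as sets are the same vertex
  data Path : Vertex → Vertex → Set (c ⊔ ℓ ⊔ lsuc p) where
    here : ∀ {I J} → ideal I ≐ᴵ ideal J → Path I J
    step : ∀ {I K J} → Adjacent I K → Path K J → Path I J

  Disconnected : Set (c ⊔ ℓ ⊔ lsuc p)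
  Disconnected = Σ Vertex λ I → Σ Vertex λ J → ¬ Path I J

  UnionOfTwoMinimal : Set (c ⊔ ℓ ⊔ lsuc p)
  UnionOfTwoMinimal =
    Σ LeftIdeal λ I → Σ LeftIdeal λ J →
      Minimal I × Minimal J × ¬ (I ≐ᴵ J) × (∀ x → mem I x ⊎ mem J x)

-- Two left ideals lying in different components of In(S) must be disjoint (else both
-- contain their intersection), must cover S (else both lie in their union), and are
-- minimal (a smaller K' ⊂ K would be joined to L through the nontrivial ideal K' ∪ L).
-- Conversely, if S = I ∪ J with I ≠ J minimal, then I ∩ J = ∅ and every nontrivial
-- left ideal equals I or J, so I has no neighbour at all.
module Submission where

open import Defs
open import Level using (Level; _⊔_; Lift; lift; lower) renaming (suc to lsuc)
open import Algebra.Bundles using (Semigroup)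
open import Axiom.ExcludedMiddle using (ExcludedMiddle)
open import Function.Bundles using (_⇔_; mk⇔)
open import Data.Product using (_×_; _,_; proj₁; proj₂) renaming (swap to ×-swap)
open import Data.Sum using (_⊎_; inj₁; inj₂; [_,_]′) renaming (swap to ⊎-swap)
open import Data.Empty using (⊥; ⊥-elim)
open import Relation.Nullary using (¬_; Dec; yes; no)
open import Relation.Nullary.Decidable using (map′)
open import Relation.Unary.Properties using (⊆′-refl; ⊆′-trans)

module _ {c ℓ p : Level} (S : Semigroup c ℓ) where
  private
    LI : Set (c ⊔ ℓ ⊔ lsuc p)
    LI = LeftIdeal S p
    V : Set (c ⊔ ℓ ⊔ lsuc p)
    V = Vertex S p

  _⊆_ _≐_ : LI → LI → Set (c ⊔ p)
  _⊆_ = _⊆ᴵ_ S p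
  _≐_ = _≐ᴵ_ S p

  record Disjoint (A B : LI) : Set (c ⊔ p) where
    constructor disjoint
    field apart : ∀ x → mem A x → mem B x → ⊥
  open Disjoint

  disjoint-sym : ∀ {A B} → Disjoint A B → Disjoint B A
  disjoint-sym A∩B=∅ = disjoint λ x b a → apart A∩B=∅ x a b

  subvertex : (A : LI) (B : V) → A ⊆ ideal S p B → V
  subvertex A (B , B≢S) A⊆B = A , λ A=S → B≢S (λ x → A⊆B x (A=S x))

  disjoint⇒⊈ : ∀ {A B} → Disjoint A B → ¬ (A ⊆ B)
  disjoint⇒⊈ {A} A∩B=∅ A⊆B = let (x , a) = nonempty A in apart A∩B=∅ x a (A⊆B x a)

  disjoint⇒nontrivial : ∀ {A B} → Disjoint A B → Nontrivial S p A
  disjoint⇒nontrivial {B = B} A∩B=∅ A=S = let (x , b) = nonempty B in apart A∩B=∅ x (A=S x) b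

  intersection : (A B : LI) → ∀ x → mem A x → mem B x → LI
  intersection A B x a b = record
    { mem      = λ y → mem A y × mem B y
    ; respects = λ e (a , b) → respects A e a , respects B e b
    ; nonempty = x , a , b
    ; closed   = λ s y (a , b) → closed A s y a , closed B s y b
    }

  _∪_ : LI → LI → LI
  A ∪ B = record
    { mem      = λ y → mem A y ⊎ mem B y
    ; respects = λ { e (inj₁ a) → inj₁ (respects A e a) ; e (inj₂ b) → inj₂ (respects B e b) }
    ; nonempty = let (x , a) = nonempty A in x , inj₁ a
    ; closed   = λ { s y (inj₁ a) → inj₁ (closed A s y a) ; s y (inj₂ b) → inj₂ (closed B s y b) }
    }

  Connected : V → V → Set (c ⊔ ℓ ⊔ lsuc p)
  Connected = Path S p

  ≐-connected : ∀ {A B C : V} → ideal S p A ≐ ideal S p B → Connected B C → Connected A C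
  ≐-connected (f , g) (here (h , k))           = here (⊆′-trans f h , ⊆′-trans k g)
  ≐-connected (f , g) (step (inj₁ (h , n)) q) = step (inj₁ (⊆′-trans f h , λ k → n (⊆′-trans k f))) q
  ≐-connected (f , g) (step (inj₂ (h , n)) q) = step (inj₂ (⊆′-trans h g , λ k → n (⊆′-trans g k))) q

  connected-trans : ∀ {A B C : V} → Connected A B → Connected B C → Connected A C
  connected-trans (here e)   q = ≐-connected e q
  connected-trans (step a r) q = step a (connected-trans r q)

  connected-sym : ∀ {A B : V} → Connected A B → Connected B A
  connected-sym (here e)   = here (×-swap e)
  connected-sym {A} (step a q) =
    connected-trans (connected-sym q) (step {K = A} (⊎-swap a) (here (⊆′-refl , ⊆′-refl)))

  module _ (em : ExcludedMiddle (c ⊔ ℓ ⊔ lsuc p)) where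

    decide : (P : Set (c ⊔ p)) → Dec P
    decide P = map′ lower lift (em {Lift (c ⊔ ℓ ⊔ lsuc p) P})

    ⊆⇒connected : ∀ (A B : V) → ideal S p A ⊆ ideal S p B → Connected A B
    ⊆⇒connected A B A⊆B with decide (ideal S p B ⊆ ideal S p A)
    ... | yes B⊆A = here (A⊆B , B⊆A)
    ... | no  B⊈A = step {K = B} (inj₁ (A⊆B , B⊈A)) (here (⊆′-refl , ⊆′-refl))

    ⊇⇒connected : ∀ (A B : V) → ideal S p B ⊆ ideal S p A → Connected A B
    ⊇⇒connected A B B⊆A = connected-sym (⊆⇒connected B A B⊆A)

    common-subideal⇒connected : ∀ {A B : V} (N : LI) → N ⊆ ideal S p A → N ⊆ ideal S p B →
                                Connected A B
    common-subideal⇒connected {A} {B} N N⊆A N⊆B =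
      connected-trans (⊇⇒connected A N′ N⊆A) (⊆⇒connected N′ B N⊆B)
      where
      N′ : V
      N′ = subvertex N A N⊆A

    common-superideal⇒connected : ∀ {A B : V} (M : V) → ideal S p A ⊆ ideal S p M → ideal S p B ⊆ ideal S p M →
                                  Connected A B
    common-superideal⇒connected {A} {B} M A⊆M B⊆M =
      connected-trans (⊆⇒connected A M A⊆M) (⊇⇒connected M B B⊆M)

    module _ {K L : V} (K≁L : ¬ Connected K L) where

      unconnected⇒disjoint : Disjoint (ideal S p K) (ideal S p L)
      unconnected⇒disjoint = disjoint λ x k l →
        K≁L (common-subideal⇒connected (intersection (ideal S p K) (ideal S p L) x k l)
                                       (λ _ → proj₁) (λ _ → proj₂))

      unconnected⇒covering : ∀ x → mem (ideal S p K) x ⊎ mem (ideal S p L) x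
      unconnected⇒covering with decide (∀ x → mem (ideal S p K ∪ ideal S p L) x)
      ... | yes K∪L=S = K∪L=S
      ... | no  K∪L≢S = ⊥-elim (K≁L (common-superideal⇒connected (ideal S p K ∪ ideal S p L , K∪L≢S)
                                                                (λ _ → inj₁) (λ _ → inj₂)))

      unconnected⇒minimal : Minimal S p (ideal S p K)
      unconnected⇒minimal (K′ , K′⊆K , K⊈K′) =
        K≁L (connected-trans (⊇⇒connected K (subvertex K′ K K′⊆K) K′⊆K)
                             (common-superideal⇒connected K′∪L (λ _ → inj₁) (λ _ → inj₂)))
        where
        K⊆K′ : (∀ x → mem (K′ ∪ ideal S p L) x) → ideal S p K ⊆ K′
        K⊆K′ K′∪L=S x k with K′∪L=S x
        ... | inj₁ k′ = k′
        ... | inj₂ l  = ⊥-elim (apart unconnected⇒disjoint x k l)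
        K′∪L : V
        K′∪L = K′ ∪ ideal S p L , λ K′∪L=S → K⊈K′ (K⊆K′ K′∪L=S)

    disconnected⇒unionOfTwoMinimal : Disconnected S p → UnionOfTwoMinimal S p
    disconnected⇒unionOfTwoMinimal (K , L , K≁L) =
      ideal S p K , ideal S p L ,
      unconnected⇒minimal K≁L , unconnected⇒minimal (λ L~K → K≁L (connected-sym L~K)) ,
      (λ K≐L → K≁L (here K≐L)) , unconnected⇒covering K≁L

    minimal⇒⊆ : ∀ (A K : LI) {x} → Minimal S p A → mem K x → mem A x → A ⊆ K
    minimal⇒⊆ A K {x} A-min k a with decide (A ⊆ intersection K A x k a)
    ... | yes A⊆K∩A = λ y a′ → proj₁ (A⊆K∩A y a′)
    ... | no  A⊈K∩A = ⊥-elim (A-min (intersection K A x k a , (λ _ → proj₂) , A⊈K∩A))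

    distinct-minimal⇒disjoint : ∀ {A B} → Minimal S p A → Minimal S p B → ¬ (A ≐ B) → Disjoint A B
    distinct-minimal⇒disjoint {A} {B} A-min B-min A≢B =
      disjoint λ x a b → A≢B (minimal⇒⊆ A B A-min b a , minimal⇒⊆ B A B-min a b)

    meets-minimal⇒≐ : ∀ (I J K : LI) {x} → Minimal S p I → Minimal S p J →
                      (∀ y → mem I y ⊎ mem J y) → Nontrivial S p K →
                      mem K x → mem I x → K ≐ I
    meets-minimal⇒≐ I J K I-min J-min I∪J=S K≢S k i = K⊆I , minimal⇒⊆ I K I-min k i
      where
      K⊆I : K ⊆ I
      K⊆I y k′ with I∪J=S y
      ... | inj₁ i′ = i′
      ... | inj₂ j′ = ⊥-elim (K≢S λ z →
                        [ minimal⇒⊆ I K I-min k i z , minimal⇒⊆ J K J-min k′ j′ z ]′ (I∪J=S z))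

    unionOfTwoMinimal⇒disconnected : UnionOfTwoMinimal S p → Disconnected S p
    unionOfTwoMinimal⇒disconnected (I , J , I-min , J-min , I≢J , I∪J=S) =
      Iᵥ , Jᵥ , no-path
      where
      I∩J=∅ : Disjoint I J
      I∩J=∅ = distinct-minimal⇒disjoint I-min J-min I≢J
      J∩I=∅ : Disjoint J I
      J∩I=∅ = disjoint-sym I∩J=∅
      Iᵥ Jᵥ : V
      Iᵥ = I , disjoint⇒nontrivial I∩J=∅
      Jᵥ = J , disjoint⇒nontrivial J∩I=∅

      ≐I-or-≐J : (W : V) → ideal S p W ≐ I ⊎ ideal S p W ≐ J
      ≐I-or-≐J (W , W≢S) with nonempty W
      ... | x , w with I∪J=S x
      ... | inj₁ i = inj₁ (meets-minimal⇒≐ I J W I-min J-min I∪J=S W≢S w i)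
      ... | inj₂ j = inj₂ (meets-minimal⇒≐ J I W J-min I-min (λ y → ⊎-swap (I∪J=S y)) W≢S w j)

      isolated : ∀ {W} → ¬ Adjacent S p Iᵥ W
      isolated {W} I~W with ≐I-or-≐J W | I~W
      ... | inj₁ (W⊆I , _)   | inj₁ (_ , W⊈I)    = W⊈I W⊆I
      ... | inj₁ (_ , I⊆W)   | inj₂ (_ , I⊈W)    = I⊈W I⊆W
      ... | inj₂ (W⊆J , _)   | inj₁ (I⊆W , _)    = disjoint⇒⊈ I∩J=∅ (⊆′-trans I⊆W W⊆J)
      ... | inj₂ (_ , J⊆W)   | inj₂ (W⊆I , _)    = disjoint⇒⊈ J∩I=∅ (⊆′-trans J⊆W W⊆I)

      no-path : ¬ Connected Iᵥ Jᵥ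
      no-path (here (I⊆J , _)) = disjoint⇒⊈ I∩J=∅ I⊆J
      no-path (step {K = W} I~W _) = isolated {W} I~W

mainTheorem2 : {c ℓ p : Level} → ExcludedMiddle (c ⊔ ℓ ⊔ lsuc p) →
    (S : Semigroup c ℓ) → Disconnected S p ⇔ UnionOfTwoMinimal S p
mainTheorem2 em S =
  mk⇔ (disconnected⇒unionOfTwoMinimal S em) (unionOfTwoMinimal⇒disconnected S em)
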